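{- Let $G$ be a simple $3$-connected graph with $n$ vertices and $m$ edges. Then each of the following sequences consists of exactly $m-n-2$ operations: (a) any sequence of BG-operations from $K_4$ to $G$; (b) any sequence of BG-paths from a $K_4$-subdivision in $G$ to $G$, i.e. subgraphs $S_4\subset S_5\subset\dots\subset S_z=G$ with $S_4$ a $K_4$-subdivision and $S_{l+1}=S_l\cup P_l$ for a BG-path $P_l$ for $S_l$ (so $z=m-n+2$); (c) any sequence of removals from $G$ to $K_4$ on removable edges $e=xy$ with $|N(x)|\ge3$, $|N(y)|\ge3$ and $|N(x)\cup N(y)|\ge 5$ (neighborhoods taken in the current graph).
   Context: A graph is $3$-connected if it has more than $3$ vertices and deleting any set of at most $2$ vertices leaves a connected graph. $N(v)$ denotes the set of neighbors of $v$. BG-operations on a multigraph are: (1) add an edge $xy$ (possibly parallel); (2) subdivide an edge $ab$ by a new vertex $x$ and add an edge $xy$ for a vertex $y\notin\{a,b\}$; (3) subdivide two distinct, non-parallel edges by new vertices $x$ and $y$ and add the edge $xy$. Smoothing a vertex $v$: if $\deg(v)=2$ and $v$ has exactly two neighbors different from $v$, delete $v$ and join these two neighbors by an edge; otherwise do nothing. Removing an edge $xy$ deletes it and then smooths $x$ and $y$; an edge is removable if removing it yields a $3$-connected graph. For a subgraph $S$ of $G$ that is a subdivision of some graph, real vertices are vertices of degree $\ge 3$ in $S$; links are paths in $S$ with real end vertices and no other real vertex; two links are parallel if they share both end vertices. A BG-path for $S$ is a path $P$ in $G$ from $x$ to $y$ with (i) $P\cap S=\{x,y\}$; (ii) every link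 of $S$ containing both $x,y$ contains them as end vertices; (iii) if $x,y$ are inner vertices of links $L_x,L_y$ of $S$ and $S$ has at least $4$ real vertices, then $L_x,L_y$ are not parallel. -}

module Defs where

open import Data.Nat using (ℕ; zero; suc; _+_; _≤_; _<_; _≤ᵇ_; pred)
open import Data.Bool using (Bool; true; false; _∧_; _∨_; not; if_then_else_)
open import Data.Fin using (Fin; zero; suc; punchIn; _≟_)
open import Data.Fin.Subset using (Subset; ∣_∣; _∪_; ⁅_⁆; _-_)
import Data.Fin.Subset as Sub
open import Data.Vec using (Vec; lookup; tabulate)
open import Data.List using (List; []; _∷_; map; allFin; length)
open import Data.Nat.ListAction using (sum)
open import Data.List.Relation.Unary.All using (All)
open import Data.List.Relation.Unary.Unique.Propositional using (Unique)
open import Data.List.Membership.Propositional using (_∈_; _∉_)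
open import Data.Product using (Σ; _×_; _,_; proj₁; proj₂; swap; map₁; map₂)
import Data.Product as P
open import Data.Sum using (_⊎_)
open import Data.Maybe using (Maybe; just; nothing)
open import Relation.Nullary using (¬_; does)
open import Relation.Binary.PropositionalEquality using (_≡_; _≢_)
open import Function.Bundles using (_↔_; Inverse)
open import Function.Definitions using (Injective)

-- Finite multigraphs: vertices Fin V, edges Fin E, each edge has an
-- (arbitrarily oriented) pair of end vertices.  Loops and parallel
-- edges are allowed.

record MG : Set where
  constructor mkMG
  field
    V    : ℕ
    E    : ℕ
    ends : Fin E → Fin V × Fin V
open MG public

_==_ : ∀ {n} → Fin n → Fin n → Bool
a == b = does (a ≟ b)

Joins : (H : MG) → Fin (E H) → Fin (V H) → Fin (V H) → Set
Joins H e x z = (ends H e ≡ (x , z)) ⊎ (ends H e ≡ (z , x))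

joinsᵇ : (H : MG) → Fin (E H) → Fin (V H) → Fin (V H) → Bool
joinsᵇ H e x z = (proj₁ (ends H e) == x ∧ proj₂ (ends H e) == z)
               ∨ (proj₁ (ends H e) == z ∧ proj₂ (ends H e) == x)

ParallelE : (H : MG) → Fin (E H) → Fin (E H) → Set
ParallelE H e f = (ends H e ≡ ends H f) ⊎ (ends H e ≡ swap (ends H f))

Simple : MG → Set
Simple H = (∀ e → proj₁ (ends H e) ≢ proj₂ (ends H e))
         × (∀ e f → ParallelE H e f → e ≡ f)

-- number of ends of e equal to v (a loop counts twice)
inc : (H : MG) → Fin (E H) → Fin (V H) → ℕ
inc H e v = (if proj₁ (ends H e) == v then 1 else 0)
          + (if proj₂ (ends H e) == v then 1 else 0)

deg : (H : MG) → Fin (V H) → ℕ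
deg H v = sum (map (λ e → inc H e v) (allFin (E H)))

anyᵇ : ∀ {n} → (Fin n → Bool) → Bool
anyᵇ {n} p = Data.List.foldr _∨_ false (map p (allFin n))

-- N(v): the set of neighbours of v (contains v itself iff v has a loop)
N : (H : MG) → Fin (V H) → Subset (V H)
N H v = tabulate (λ u → anyᵇ (λ e → joinsᵇ H e u v))

data Walk (H : MG) : Fin (V H) → Fin (V H) → Set where
  []  : ∀ {x} → Walk H x x
  _∷⟨_⟩_ : ∀ {x z y} (e : Fin (E H)) → Joins H e x z → Walk H z y → Walk H x y

verts : ∀ {H x y} → Walk H x y → List (Fin (V H))
verts {x = x} []         = x ∷ []
verts {x = x} (e ∷⟨ _ ⟩ w) = x ∷ verts w

edgesW : ∀ {H x y} → Walk H x y → List (Fin (E H))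
edgesW []           = []
edgesW (e ∷⟨ _ ⟩ w) = e ∷ edgesW w

initVerts : ∀ {H x y} → Walk H x y → List (Fin (V H))
initVerts []                     = []
initVerts {x = x} (e ∷⟨ _ ⟩ w)   = x ∷ initVerts w

inner : ∀ {H x y} → Walk H x y → List (Fin (V H))
inner []           = []
inner (e ∷⟨ _ ⟩ w) = initVerts w

NonTrivial : ∀ {H x y} → Walk H x y → Set
NonTrivial []          = Data.Empty.⊥ where import Data.Empty
NonTrivial (_ ∷⟨ _ ⟩ _) = Data.Unit.⊤ where import Data.Unit

IsPath : ∀ {H x y} → Walk H x y → Set
IsPath w = NonTrivial w × Unique (verts w)

ThreeConnected : MG → Set
ThreeConnected H =
  (3 < V H) ×
  (∀ (X : List (Fin (V H))) → length X ≤ 2 →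
     ∀ u v → u ∉ X → v ∉ X →
     Σ (Walk H u v) λ w → All (λ z → z ∉ X) (verts w))

record _≅_ (H K : MG) : Set where
  field
    vmap : Fin (V H) ↔ Fin (V K)
    emap : Fin (E H) ↔ Fin (E K)
    resp : ∀ e → (ends K (Inverse.to emap e) ≡ P.map (Inverse.to vmap) (Inverse.to vmap) (ends H e))
               ⊎ (ends K (Inverse.to emap e) ≡ swap (P.map (Inverse.to vmap) (Inverse.to vmap) (ends H e)))
open _≅_ public

K4 : MG
K4 = mkMG 4 6 e
  where
  e : Fin 6 → Fin 4 × Fin 4
  e zero                               = (zero , suc zero)
  e (suc zero)                         = (zero , suc (suc zero))
  e (suc (suc zero))                   = (zero , suc (suc (suc zero)))
  e (suc (suc (suc zero)))             = (suc zero , suc (suc zero))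
  e (suc (suc (suc (suc zero))))       = (suc zero , suc (suc (suc zero)))
  e (suc (suc (suc (suc (suc zero))))) = (suc (suc zero) , suc (suc (suc zero)))

-- add an edge xy (new edge is `zero`)
addEdge : (H : MG) → Fin (V H) → Fin (V H) → MG
addEdge H x y = mkMG (V H) (suc (E H)) f
  where
  f : Fin (suc (E H)) → Fin (V H) × Fin (V H)
  f zero    = (x , y)
  f (suc i) = ends H i

-- subdivide edge e = ab by a new vertex `zero` (old vertices are shifted
-- by suc): e becomes a–new (index suc e), new edge new–b has index zero
subdivide : (H : MG) → Fin (E H) → MG
subdivide H e = mkMG (suc (V H)) (suc (E H)) f
  where
  f : Fin (suc (E H)) → Fin (suc (V H)) × Fin (suc (V H))
  f zero    = (zero , suc (proj₂ (ends H e)))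
  f (suc i) = if i == e then (suc (proj₁ (ends H e)) , zero)
                        else P.map suc suc (ends H i)

punchIn' : ∀ {n} → Fin n → Fin (pred n) → Fin n
punchIn' {suc n} e i = punchIn e i

deleteEdge : (H : MG) → Fin (E H) → MG
deleteEdge H e = mkMG (V H) (pred (E H)) (λ i → ends H (punchIn' e i))

-- (a) BG-operations.  The new vertices of operations (2),(3) are the
-- vertices created by `subdivide`.

data BGStep (H : MG) : MG → Set where
  op1 : (x y : Fin (V H)) → x ≢ y → BGStep H (addEdge H x y)
  op2 : (e : Fin (E H)) (y : Fin (V H)) →
        y ≢ proj₁ (ends H e) → y ≢ proj₂ (ends H e) →
        BGStep H (addEdge (subdivide H e) zero (suc y))
  op3 : (e f : Fin (E H)) → e ≢ f → ¬ ParallelE H e f →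
        BGStep H (addEdge (subdivide (subdivide H e) (suc f)) (suc zero) zero)

data BGSeq : MG → MG → ℕ → Set where
  done : ∀ {H} → BGSeq H H 0
  step : ∀ {H H' H'' k} → BGStep H H' → BGSeq H' H'' k → BGSeq H H'' (suc k)

data SubdivOf (K : MG) : MG → Set where
  base : SubdivOf K K
  sub  : ∀ {H} → SubdivOf K H → (e : Fin (E H)) → SubdivOf K (subdivide H e)

-- subgraphs of G are given by their edge sets
InS : (G : MG) → Subset (E G) → Fin (E G) → Set
InS G S e = lookup S e ≡ true

-- vertex set of the subgraph S: vertices incident to an edge of S
InVS : (G : MG) → Subset (E G) → Fin (V G) → Set
InVS G S v = Σ (Fin (E G)) λ e → InS G S e × ((proj₁ (ends G e) ≡ v) ⊎ (proj₂ (ends G e) ≡ v))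

record SubgraphIso (H G : MG) (S : Subset (E G)) : Set where
  field
    vmap  : Fin (V H) → Fin (V G)
    emap  : Fin (E H) → Fin (E G)
    vinj  : Injective _≡_ _≡_ vmap
    einj  : Injective _≡_ _≡_ emap
    resp  : ∀ e → (ends G (emap e) ≡ P.map vmap vmap (ends H e))
                ⊎ (ends G (emap e) ≡ swap (P.map vmap vmap (ends H e)))
    eimg₁ : ∀ e → InS G S (emap e)
    eimg₂ : ∀ f → InS G S f → Σ (Fin (E H)) λ e → emap e ≡ f
    vimg₁ : ∀ u → InVS G S (vmap u)
    vimg₂ : ∀ v → InVS G S v → Σ (Fin (V H)) λ u → vmap u ≡ v

K4SubdivIn : (G : MG) → Subset (E G) → Set
K4SubdivIn G S = Σ MG λ H → SubdivOf K4 H × SubgraphIso H G S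

degS : (G : MG) → Subset (E G) → Fin (V G) → ℕ
degS G S v = sum (map (λ e → if lookup S e then inc G e v else 0) (allFin (E G)))

Real : (G : MG) → Subset (E G) → Fin (V G) → Set
Real G S v = 3 ≤ degS G S v

realSet : (G : MG) → Subset (E G) → Subset (V G)
realSet G S = tabulate (λ v → 3 ≤ᵇ degS G S v)

record Link (G : MG) (S : Subset (E G)) : Set where
  field
    a b     : Fin (V G)
    walk    : Walk G a b
    isPath  : IsPath walk
    inS     : All (InS G S) (edgesW walk)
    realA   : Real G S a
    realB   : Real G S b
    innerNR : All (λ u → ¬ Real G S u) (inner walk)
open Link public

linkVerts : ∀ {G S} → Link G S → List (Fin (V G))
linkVerts L = verts (walk L)

linkInner : ∀ {G S} → Link G S → List (Fin (V G))
linkInner L = inner (walk L)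

EndsOf : ∀ {G S} → Link G S → Fin (V G) → Fin (V G) → Set
EndsOf L x y = ((x ≡ a L) × (y ≡ b L)) ⊎ ((x ≡ b L) × (y ≡ a L))

ParallelL : ∀ {G S} → Link G S → Link G S → Set
ParallelL L L' = EndsOf L (a L') (b L')

record BGPath (G : MG) (S : Subset (E G)) {x y : Fin (V G)} (P : Walk G x y) : Set where
  field
    isPath   : IsPath P
    -- (i) P ∩ S = {x, y}
    xInS     : InVS G S x
    yInS     : InVS G S y
    innerOut : All (λ u → ¬ InVS G S u) (inner P)
    edgesOut : All (λ e → ¬ InS G S e) (edgesW P)
    cond2    : ∀ (L : Link G S) → x ∈ linkVerts L → y ∈ linkVerts L → EndsOf L x y
    cond3    : 4 ≤ ∣ realSet G S ∣ → ∀ (Lx Ly : Link G S) →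
               x ∈ linkInner Lx → y ∈ linkInner Ly → ¬ ParallelL Lx Ly

edgeSet : ∀ {G x y} → Walk G x y → Subset (E G)
edgeSet w = Data.List.foldr (λ e s → ⁅ e ⁆ ∪ s) Sub.⊥ (edgesW w)

data BGPathSeq (G : MG) : Subset (E G) → Subset (E G) → ℕ → Set where
  done : ∀ {S} → BGPathSeq G S S 0
  step : ∀ {S S' k x y} (P : Walk G x y) → BGPath G S P →
         BGPathSeq G (S ∪ edgeSet P) S' k → BGPathSeq G S S' (suc k)

SmoothCond : (H : MG) → Fin (V H) → Set
SmoothCond H v = (deg H v ≡ 2) × (∣ N H v - v ∣ ≡ 2)

unsuc : ∀ {n} → Fin (suc n) → Maybe (Fin n)
unsuc zero    = nothing
unsuc (suc i) = just i

-- Smooth H v H' ρ : smoothing v in H gives H' (up to isomorphism); ρ tracks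
-- the surviving vertices.  If the smoothing condition holds, deleting v
-- and joining its two neighbours by an edge e yields H', i.e. H is H'
-- with e subdivided by v.
data Smooth (H : MG) (v : Fin (V H)) : (H' : MG) → (Fin (V H) → Maybe (Fin (V H'))) → Set where
  keep   : ¬ SmoothCond H v → Smooth H v H just
  smooth : SmoothCond H v → (H' : MG) (e : Fin (E H')) (φ : subdivide H' e ≅ H) →
           Inverse.to (vmap φ) zero ≡ v →
           Smooth H v H' (λ u → unsuc (Inverse.from (vmap φ) u))

-- Removal H e H' : removing e = xy (delete e, smooth x, then smooth y)
Removal : (H : MG) → Fin (E H) → MG → Set
Removal H e H'' =
  Σ MG λ H₂ → Σ (Fin (V H) → Maybe (Fin (V H₂))) λ ρ →
    Smooth (deleteEdge H e) (proj₁ (ends H e)) H₂ ρ ×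
    Σ (Fin (V H₂)) λ y' → (ρ (proj₂ (ends H e)) ≡ just y') ×
    Σ (Fin (V H₂) → Maybe (Fin (V H''))) λ ρ' → Smooth H₂ y' H'' ρ'

RemStep : MG → MG → Set
RemStep H H' = Σ (Fin (E H)) λ e →
  (3 ≤ ∣ N H (proj₁ (ends H e)) ∣) × (3 ≤ ∣ N H (proj₂ (ends H e)) ∣) ×
  (5 ≤ ∣ N H (proj₁ (ends H e)) ∪ N H (proj₂ (ends H e)) ∣) ×
  Removal H e H' × ThreeConnected H'

data RemSeq : MG → MG → ℕ → Set where
  done : ∀ {H} → RemSeq H H 0
  step : ∀ {H H' H'' k} → RemStep H H' → RemSeq H' H'' k → RemSeq H H'' (suc k)

module Submission where

-- Each of the three kinds of sequences changes the quantity |E| − |V|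
-- ("edges minus vertices") by exactly one per step, and both ends of the
-- sequences are pinned down: K4 and every K4-subdivision have |E| − |V| = 2,
-- while G has |E G| − |V G|.

open import Defs
open import Data.Nat using (ℕ; _∸_)
open import Data.Product using (_×_)
open import Data.Fin.Subset using (Subset; ⊤)
open import Relation.Binary.PropositionalEquality using (_≡_)

open import Data.Nat using (suc; _+_; _<_; z≤n; s≤s)
open import Data.Nat.Properties using (≤-trans; +-identityʳ; +-suc; +-comm; +-cancelʳ-≡; m+n∸m≡n)
open import Data.Nat.Tactic.RingSolver using (solve-∀)
open import Data.Bool using (true; false)
import Data.Bool as Bool
open import Data.Fin using (Fin; zero; suc)
import Data.Fin as Fin
open import Data.Fin.Properties using (any?; cantor-schröder-bernstein)
open import Data.Fin.Subset using (⊥; ⁅_⁆; _∪_; _∩_; ∣_∣; _∈_; _⊆_; Empty)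
open import Data.Fin.Subset.Properties
  using (x∈p∪q⁺; x∈p∪q⁻; x∈p∩q⁺; x∈p∩q⁻; ∉⊥; ∈⊤; ⊆⊤; x∈⁅x⁆; x∈⁅y⁆⇒x≡y; ⊆-antisym;
         ∣⁅x⁆∣≡1; ∣⊥∣≡0; ∣⊤∣≡n; Empty-unique)
open import Data.Vec using ([]; _∷_; lookup; tabulate)
open import Data.Vec.Properties using ([]=⇒lookup; lookup⇒[]=; lookup∘tabulate)
open import Data.List using (List; []; _∷_; length; map; allFin; foldr)
import Data.List.Membership.Propositional as List
open import Data.List.Membership.Propositional.Properties using (∈-map⁺; ∈-map⁻; ∈-allFin)
open import Data.List.Relation.Unary.Any using (here; there)
open import Data.List.Relation.Unary.All using ([]; _∷_) renaming (lookup to All-lookup)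
open import Data.List.Relation.Unary.All.Properties using (All¬⇒¬Any; ¬Any⇒All¬)
open import Data.List.Relation.Unary.Unique.Propositional using (Unique)
open import Data.List.Relation.Unary.Unique.Propositional.Properties using (map⁺; allFin⁺)
open import Data.List.Relation.Unary.AllPairs using ([]; _∷_)
open import Data.List.Properties using (length-map; length-tabulate)
open import Data.Product using (∃; _,_; proj₁; proj₂)
open import Data.Sum using (_⊎_; inj₁; inj₂)
open import Data.Unit using (tt)
open import Function.Bundles using (_↔_; Injection)
open import Function.Definitions using (Injective)
open import Function.Properties.Inverse using (↔-sym; ↔⇒↣)
open import Relation.Binary.PropositionalEquality using (_≢_; refl; sym; trans; cong; cong₂; subst; subst₂)
open Relation.Binary.PropositionalEquality.≡-Reasoning
open import Relation.Nullary using (¬_; does; yes; no; contradiction; _×-dec_)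
open import Relation.Nullary.Decidable using (dec-true; _⊎-dec_)
open import Relation.Unary using (Pred; Decidable)

∣∪∣+∣∩∣ : ∀ {n} (p q : Subset n) → ∣ p ∪ q ∣ + ∣ p ∩ q ∣ ≡ ∣ p ∣ + ∣ q ∣
∣∪∣+∣∩∣ []            []            = refl
∣∪∣+∣∩∣ (true  ∷ p) (true  ∷ q) =
  cong suc (trans (+-suc _ _) (trans (cong suc (∣∪∣+∣∩∣ p q)) (sym (+-suc _ _))))
∣∪∣+∣∩∣ (true  ∷ p) (false ∷ q) = cong suc (∣∪∣+∣∩∣ p q)
∣∪∣+∣∩∣ (false ∷ p) (true  ∷ q) = trans (cong suc (∣∪∣+∣∩∣ p q)) (sym (+-suc _ _))
∣∪∣+∣∩∣ (false ∷ p) (false ∷ q) = ∣∪∣+∣∩∣ p q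

∣∪∣-disjoint : ∀ {n} (p q : Subset n) → Empty (p ∩ q) → ∣ p ∪ q ∣ ≡ ∣ p ∣ + ∣ q ∣
∣∪∣-disjoint {n} p q disjoint = begin
  ∣ p ∪ q ∣           ≡⟨ sym (+-identityʳ _) ⟩
  ∣ p ∪ q ∣ + 0       ≡⟨ cong (∣ p ∪ q ∣ +_) ∣p∩q∣≡0 ⟨
  ∣ p ∪ q ∣ + ∣ p ∩ q ∣ ≡⟨ ∣∪∣+∣∩∣ p q ⟩
  ∣ p ∣ + ∣ q ∣       ∎
  where
  ∣p∩q∣≡0 : ∣ p ∩ q ∣ ≡ 0
  ∣p∩q∣≡0 = trans (cong ∣_∣ (Empty-unique disjoint)) (∣⊥∣≡0 n)

-- The set of entries of a list.  (`edgeSet w` of Defs is `listSet (edgesW w)`.)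
listSet : ∀ {n} → List (Fin n) → Subset n
listSet = foldr (λ x s → ⁅ x ⁆ ∪ s) ⊥

∈listSet⁺ : ∀ {n} {i : Fin n} xs → i List.∈ xs → i ∈ listSet xs
∈listSet⁺ (x ∷ _)  (here refl)  = x∈p∪q⁺ (inj₁ (x∈⁅x⁆ x))
∈listSet⁺ (_ ∷ xs) (there i∈xs) = x∈p∪q⁺ (inj₂ (∈listSet⁺ xs i∈xs))

∈listSet⁻ : ∀ {n} {i : Fin n} xs → i ∈ listSet xs → i List.∈ xs
∈listSet⁻ []       i∈ = contradiction i∈ ∉⊥
∈listSet⁻ (x ∷ xs) i∈ with x∈p∪q⁻ ⁅ x ⁆ (listSet xs) i∈
... | inj₁ i∈x  = here (x∈⁅y⁆⇒x≡y x i∈x)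
... | inj₂ i∈xs = there (∈listSet⁻ xs i∈xs)

∣listSet∣ : ∀ {n} {xs : List (Fin n)} → Unique xs → ∣ listSet xs ∣ ≡ length xs
∣listSet∣ {n} {[]}     []           = ∣⊥∣≡0 n
∣listSet∣ {n} {x ∷ xs} (x∉xs ∷ uniq) = begin
  ∣ ⁅ x ⁆ ∪ listSet xs ∣       ≡⟨ ∣∪∣-disjoint ⁅ x ⁆ (listSet xs) disjoint ⟩
  ∣ ⁅ x ⁆ ∣ + ∣ listSet xs ∣   ≡⟨ cong₂ _+_ (∣⁅x⁆∣≡1 x) (∣listSet∣ uniq) ⟩
  suc (length xs)             ∎
  where
  disjoint : Empty (⁅ x ⁆ ∩ listSet xs)
  disjoint (i , i∈) with x∈p∩q⁻ ⁅ x ⁆ (listSet xs) i∈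
  ... | i∈x , i∈xs = All¬⇒¬Any x∉xs
                       (subst (List._∈ xs) (x∈⁅y⁆⇒x≡y x i∈x) (∈listSet⁻ xs i∈xs))

∣image∣ : ∀ {m n} {p : Subset n} (f : Fin m → Fin n) → Injective _≡_ _≡_ f →
          (∀ i → f i ∈ p) → (∀ j → j ∈ p → ∃ λ i → f i ≡ j) → ∣ p ∣ ≡ m
∣image∣ {m} {p = p} f inj into onto = begin
  ∣ p ∣                          ≡⟨ cong ∣_∣ p≡image ⟩
  ∣ listSet (map f (allFin m)) ∣ ≡⟨ ∣listSet∣ (map⁺ inj (allFin⁺ m)) ⟩
  length (map f (allFin m))      ≡⟨ length-map f (allFin m) ⟩
  length (allFin m)              ≡⟨ length-tabulate (λ i → i) ⟩
  m                              ∎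
  where
  p≡image : p ≡ listSet (map f (allFin m))
  p≡image = ⊆-antisym
    (λ {j} j∈p → let (i , fi≡j) = onto j j∈p in
       ∈listSet⁺ (map f (allFin m)) (subst (List._∈ map f (allFin m)) fi≡j (∈-map⁺ f (∈-allFin i))))
    (λ {j} j∈im → let (i , _ , j≡fi) = ∈-map⁻ f (∈listSet⁻ (map f (allFin m)) j∈im) in
       subst (_∈ p) (sym j≡fi) (into i))

⟦_⟧ : ∀ {n ℓ} {P : Pred (Fin n) ℓ} → Decidable P → Subset n
⟦ P? ⟧ = tabulate (λ i → does (P? i))

∈⟦⟧⁺ : ∀ {n ℓ} {P : Pred (Fin n) ℓ} (P? : Decidable P) {i} → P i → i ∈ ⟦ P? ⟧
∈⟦⟧⁺ P? {i} Pi = lookup⇒[]= i _ (trans (lookup∘tabulate _ i) (dec-true (P? i) Pi))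

∈⟦⟧⁻ : ∀ {n ℓ} {P : Pred (Fin n) ℓ} (P? : Decidable P) {i} → i ∈ ⟦ P? ⟧ → P i
∈⟦⟧⁻ P? {i} i∈ with P? i | trans (sym (lookup∘tabulate (λ j → does (P? j)) i)) ([]=⇒lookup i∈)
... | yes Pi | _ = Pi
... | no _   | ()

-- `Gain (e₀ , v₀) (e₁ , v₁) k`: going from e₀ edges and v₀ vertices to e₁
-- edges and v₁ vertices increases |E| − |V| by exactly k.  It is a record
-- (rather than the bare equation) so that the counts can be inferred.
record Gain (s t : ℕ × ℕ) (k : ℕ) : Set where
  constructor gain
  field balance : proj₁ t + proj₂ s ≡ proj₁ s + proj₂ t + k

gain-refl : ∀ s → Gain s s 0
gain-refl (e , v) = gain (sym (+-identityʳ (e + v)))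

gain-trans : ∀ {s t u j k} → Gain s t j → Gain t u k → Gain s u (j + k)
gain-trans {e₀ , v₀} {e₁ , v₁} {e₂ , v₂} {j} {k} (gain st) (gain tu) =
  gain (+-cancelʳ-≡ (e₁ + v₁) (e₂ + v₀) (e₀ + v₂ + (j + k)) (begin
    e₂ + v₀ + (e₁ + v₁)            ≡⟨ regroup e₂ v₀ e₁ v₁ ⟩
    (e₂ + v₁) + (e₁ + v₀)          ≡⟨ cong₂ _+_ tu st ⟩
    (e₁ + v₂ + k) + (e₀ + v₁ + j)  ≡⟨ collect e₀ e₁ v₁ v₂ j k ⟩
    e₀ + v₂ + (j + k) + (e₁ + v₁)  ∎))
  where
  regroup : ∀ a b c d → a + b + (c + d) ≡ (a + d) + (c + b)
  regroup = solve-∀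
  collect : ∀ e₀ e₁ v₁ v₂ j k → (e₁ + v₂ + k) + (e₀ + v₁ + j) ≡ e₀ + v₂ + (j + k) + (e₁ + v₁)
  collect = solve-∀

gain-add : ∀ d k e v → Gain (e , v) (k + d + e , d + v) k
gain-add d k e v = gain (rearrange d k e v)
  where
  rearrange : ∀ d k e v → k + d + e + v ≡ e + (d + v) + k
  rearrange = solve-∀

-- Gluing on ℓ new edges and ℓ + 1 vertices, two of which were present already, gains 1.
gain-glue : ∀ {c g c' g'} ℓ → c' ≡ c + ℓ → g' + 2 ≡ g + suc ℓ → Gain (c , g) (c' , g') 1
gain-glue {c} {g} {c'} {g'} ℓ refl vertices =
  gain (+-cancelʳ-≡ 2 (c + ℓ + g) (c + g' + 1) (begin
    c + ℓ + g + 2      ≡⟨ regroup c ℓ g ⟩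
    c + (g + suc ℓ) + 1 ≡⟨ cong (λ t → c + t + 1) vertices ⟨
    c + (g' + 2) + 1   ≡⟨ regroup' c g' ⟩
    c + g' + 1 + 2     ∎))
  where
  regroup : ∀ c ℓ g → c + ℓ + g + 2 ≡ c + (g + suc ℓ) + 1
  regroup = solve-∀
  regroup' : ∀ c g' → c + (g' + 2) + 1 ≡ c + g' + 1 + 2
  regroup' = solve-∀

gain-from-2 : ∀ {e₀ v₀ e v k} → e₀ ≡ v₀ + 2 → Gain (e₀ , v₀) (e , v) k → k ≡ e ∸ v ∸ 2
gain-from-2 {e₀} {v₀} {e} {v} {k} refl (gain balance) = sym (begin
  e ∸ v ∸ 2           ≡⟨ cong (λ t → t ∸ v ∸ 2) e≡v+2+k ⟩
  v + (2 + k) ∸ v ∸ 2 ≡⟨ cong (_∸ 2) (m+n∸m≡n v (2 + k)) ⟩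
  k                   ∎)
  where
  e≡v+2+k : e ≡ v + (2 + k)
  e≡v+2+k = +-cancelʳ-≡ v₀ e (v + (2 + k)) (trans balance (regroup v₀ v k))
    where
    regroup : ∀ v₀ v k → v₀ + 2 + v + k ≡ v + (2 + k) + v₀
    regroup = solve-∀

size : MG → ℕ × ℕ
size H = E H , V H

↔⇒≡ : ∀ {m n} → Fin m ↔ Fin n → m ≡ n
↔⇒≡ φ = cantor-schröder-bernstein (Injection.injective (↔⇒↣ φ))
                                  (Injection.injective (↔⇒↣ (↔-sym φ)))

≅⇒size≡ : ∀ {H K} → H ≅ K → size H ≡ size K
≅⇒size≡ φ = cong₂ _,_ (↔⇒≡ (emap φ)) (↔⇒≡ (vmap φ))

bgStep-gain : ∀ {H H'} → BGStep H H' → Gain (size H) (size H') 1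
bgStep-gain {H} (op1 _ _ _)     = gain-add 0 1 (E H) (V H)
bgStep-gain {H} (op2 _ _ _ _)   = gain-add 1 1 (E H) (V H)
bgStep-gain {H} (op3 _ _ _ _)   = gain-add 2 1 (E H) (V H)

bgSeq-gain : ∀ {H H' k} → BGSeq H H' k → Gain (size H) (size H') k
bgSeq-gain {H} done     = gain-refl (size H)
bgSeq-gain (step s sq)  = gain-trans (bgStep-gain s) (bgSeq-gain sq)

smooth-gain : ∀ {H v H' ρ} → Smooth H v H' ρ → Gain (size H') (size H) 0
smooth-gain {H} (keep _)             = gain-refl (size H)
smooth-gain {H' = H'} (smooth _ _ _ φ _) =
  subst (λ s → Gain (size H') s 0) (≅⇒size≡ φ) (gain-add 1 0 (E H') (V H'))

-- Deleting an edge loses 1 (stated as: putting it back gains 1).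
deleteEdge-gain : ∀ H e → Gain (size (deleteEdge H e)) (size H) 1
deleteEdge-gain (mkMG v (suc m) _) _ = gain-add 0 1 m v

removal-gain : ∀ {H e H'} → Removal H e H' → Gain (size H') (size H) 1
removal-gain {H} {e} (_ , _ , smooth-x , _ , _ , _ , smooth-y) =
  gain-trans (smooth-gain smooth-y) (gain-trans (smooth-gain smooth-x) (deleteEdge-gain H e))

remSeq-gain : ∀ {H H' k} → RemSeq H H' k → Gain (size H') (size H) k
remSeq-gain {H} done = gain-refl (size H)
remSeq-gain {H} {k = suc k} (step (e , _ , _ , _ , removal , _) sq) =
  subst (Gain _ _) (+-comm k 1) (gain-trans (remSeq-gain sq) (removal-gain {H} {e} removal))

Incident : (H : MG) → Fin (E H) → Fin (V H) → Set
Incident H e v = (proj₁ (ends H e) ≡ v) ⊎ (proj₂ (ends H e) ≡ v)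

module _ {H : MG} where

  joins-incident₁ : ∀ e {x z} → Joins H e x z → Incident H e x
  joins-incident₁ _ (inj₁ e≡xz) = inj₁ (cong proj₁ e≡xz)
  joins-incident₁ _ (inj₂ e≡zx) = inj₂ (cong proj₂ e≡zx)

  joins-incident₂ : ∀ e {x z} → Joins H e x z → Incident H e z
  joins-incident₂ _ (inj₁ e≡xz) = inj₂ (cong proj₂ e≡xz)
  joins-incident₂ _ (inj₂ e≡zx) = inj₁ (cong proj₁ e≡zx)

  incident-joins : ∀ e {x z v} → Joins H e x z → Incident H e v → v ≡ x ⊎ v ≡ z
  incident-joins _ (inj₁ e≡xz) (inj₁ refl) = inj₁ (cong proj₁ e≡xz)
  incident-joins _ (inj₁ e≡xz) (inj₂ refl) = inj₂ (cong proj₂ e≡xz)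
  incident-joins _ (inj₂ e≡zx) (inj₁ refl) = inj₂ (cong proj₁ e≡zx)
  incident-joins _ (inj₂ e≡zx) (inj₂ refl) = inj₁ (cong proj₂ e≡zx)

  first∈ : ∀ {x y} (w : Walk H x y) → x List.∈ verts w
  first∈ []          = here refl
  first∈ (_ ∷⟨ _ ⟩ _) = here refl

  last∈ : ∀ {x y} (w : Walk H x y) → y List.∈ verts w
  last∈ []          = here refl
  last∈ (_ ∷⟨ _ ⟩ w) = there (last∈ w)

  incident∈verts : ∀ {x y e v} (w : Walk H x y) → e List.∈ edgesW w → Incident H e v → v List.∈ verts w
  incident∈verts (_ ∷⟨ j ⟩ w) (here refl) inc with incident-joins _ j inc
  ... | inj₁ refl = here refl
  ... | inj₂ refl = there (first∈ w)
  incident∈verts (_ ∷⟨ _ ⟩ w) (there e∈w) inc = there (incident∈verts w e∈w inc)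

  verts-incident : ∀ {x y v} (w : Walk H x y) → NonTrivial w → v List.∈ verts w →
                   ∃ λ e → e List.∈ edgesW w × Incident H e v
  verts-incident (e ∷⟨ j ⟩ w)  _ (here refl)          = e , here refl , joins-incident₁ e j
  verts-incident (e ∷⟨ j ⟩ []) _ (there (here refl))  = e , here refl , joins-incident₂ e j
  verts-incident (_ ∷⟨ _ ⟩ w@(_ ∷⟨ _ ⟩ _)) _ (there v∈w) =
    let (e , e∈w , inc) = verts-incident w tt v∈w in e , there e∈w , inc

  edges-unique : ∀ {x y} (w : Walk H x y) → Unique (verts w) → Unique (edgesW w)
  edges-unique []           _             = []
  edges-unique (e ∷⟨ j ⟩ w) (x∉w ∷ uniq) = ¬Any⇒All¬ _ e∉w ∷ edges-unique w uniq
    where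
    e∉w : ¬ (e List.∈ edgesW w)
    e∉w e∈w = All¬⇒¬Any x∉w (incident∈verts w e∈w (joins-incident₁ e j))

  length-verts : ∀ {x y} (w : Walk H x y) → length (verts w) ≡ suc (length (edgesW w))
  length-verts []           = refl
  length-verts (_ ∷⟨ _ ⟩ w) = cong suc (length-verts w)

  verts-split : ∀ {x y v} (w : Walk H x y) → v List.∈ verts w → v List.∈ initVerts w ⊎ v ≡ y
  verts-split []           (here refl) = inj₂ refl
  verts-split (_ ∷⟨ _ ⟩ _) (here refl) = inj₁ (here refl)
  verts-split (_ ∷⟨ _ ⟩ w) (there v∈w) with verts-split w v∈w
  ... | inj₁ v∈init = inj₁ (there v∈init)
  ... | inj₂ v≡y    = inj₂ v≡y

  verts-cases : ∀ {x y v} (w : Walk H x y) → v List.∈ verts w → v ≡ x ⊎ v List.∈ inner w ⊎ v ≡ y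
  verts-cases []           (here refl) = inj₁ refl
  verts-cases (_ ∷⟨ _ ⟩ _) (here refl) = inj₁ refl
  verts-cases (_ ∷⟨ _ ⟩ w) (there v∈w) = inj₂ (verts-split w v∈w)

  path-ends-distinct : ∀ {x y} (w : Walk H x y) → IsPath w → x ≢ y
  path-ends-distinct (_ ∷⟨ _ ⟩ w) (_ , x∉w ∷ _) refl = All¬⇒¬Any x∉w (last∈ w)

  first-edge : ∀ {x y} (w : Walk H x y) → x ≢ y → ∃ λ e → Incident H e x
  first-edge []           x≢x = contradiction refl x≢x
  first-edge (e ∷⟨ j ⟩ _) _   = e , joins-incident₁ e j

another-element : ∀ {n} → 1 < n → (v : Fin n) → ∃ λ w → v ≢ w
another-element (s≤s (s≤s _)) zero    = suc zero , λ ()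
another-element (s≤s (s≤s _)) (suc v) = zero , λ ()

module _ (G : MG) where

  InVS? : (S : Subset (E G)) → Decidable (InVS G S)
  InVS? S v = any? λ e → (lookup S e Bool.≟ true)
                         ×-dec ((proj₁ (ends G e) Fin.≟ v) ⊎-dec (proj₂ (ends G e) Fin.≟ v))

  vertexSet : Subset (E G) → Subset (V G)
  vertexSet S = ⟦ InVS? S ⟧

  sizeS : Subset (E G) → ℕ × ℕ
  sizeS S = ∣ S ∣ , ∣ vertexSet S ∣

  vertex-intro : ∀ {S e v} → e ∈ S → Incident G e v → v ∈ vertexSet S
  vertex-intro {S} e∈S inc = ∈⟦⟧⁺ (InVS? S) (_ , []=⇒lookup e∈S , inc)

  vertex-elim : ∀ {S v} → v ∈ vertexSet S → ∃ λ e → e ∈ S × Incident G e v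
  vertex-elim {S} v∈S with ∈⟦⟧⁻ (InVS? S) v∈S
  ... | e , e∈S , inc = e , lookup⇒[]= e S e∈S , inc

  module _ (S : Subset (E G)) where

    vertexSet-extend : ∀ {x y} (P : Walk G x y) → NonTrivial P →
                       vertexSet (S ∪ edgeSet P) ≡ vertexSet S ∪ listSet (verts P)
    vertexSet-extend P nontrivial = ⊆-antisym extended⊆ ⊆extended
      where
      extended⊆ : vertexSet (S ∪ edgeSet P) ⊆ vertexSet S ∪ listSet (verts P)
      extended⊆ v∈ with vertex-elim v∈
      ... | e , e∈S∪P , inc with x∈p∪q⁻ S (edgeSet P) e∈S∪P
      ...   | inj₁ e∈S = x∈p∪q⁺ (inj₁ (vertex-intro e∈S inc))
      ...   | inj₂ e∈P = x∈p∪q⁺ (inj₂ (∈listSet⁺ (verts P) (incident∈verts P (∈listSet⁻ (edgesW P) e∈P) inc)))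
      ⊆extended : vertexSet S ∪ listSet (verts P) ⊆ vertexSet (S ∪ edgeSet P)
      ⊆extended v∈ with x∈p∪q⁻ (vertexSet S) (listSet (verts P)) v∈
      ... | inj₁ v∈S = let (e , e∈S , inc) = vertex-elim v∈S in
                       vertex-intro {S ∪ edgeSet P} (x∈p∪q⁺ (inj₁ e∈S)) inc
      ... | inj₂ v∈P = let (e , e∈P , inc) = verts-incident P nontrivial (∈listSet⁻ (verts P) v∈P) in
                       vertex-intro {S ∪ edgeSet P} (x∈p∪q⁺ (inj₂ (∈listSet⁺ (edgesW P) e∈P))) inc

    module _ {x y} (P : Walk G x y) (bg : BGPath G S P) where
      open BGPath bg using (xInS; yInS; innerOut; edgesOut) renaming (isPath to P-isPath)

      bgPath-edges-disjoint : Empty (S ∩ edgeSet P)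
      bgPath-edges-disjoint (e , e∈) with x∈p∩q⁻ S (edgeSet P) e∈
      ... | e∈S , e∈P = All-lookup edgesOut (∈listSet⁻ (edgesW P) e∈P) ([]=⇒lookup e∈S)

      bgPath-meet : vertexSet S ∩ listSet (verts P) ≡ listSet (x ∷ y ∷ [])
      bgPath-meet = ⊆-antisym meet⊆ ⊆meet
        where
        meet⊆ : vertexSet S ∩ listSet (verts P) ⊆ listSet (x ∷ y ∷ [])
        meet⊆ v∈ with x∈p∩q⁻ (vertexSet S) (listSet (verts P)) v∈
        ... | v∈S , v∈P with verts-cases P (∈listSet⁻ (verts P) v∈P)
        ...   | inj₁ refl           = ∈listSet⁺ (x ∷ y ∷ []) (here refl)
        ...   | inj₂ (inj₂ refl)    = ∈listSet⁺ (x ∷ y ∷ []) (there (here refl))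
        ...   | inj₂ (inj₁ v∈inner) = contradiction (∈⟦⟧⁻ (InVS? S) v∈S) (All-lookup innerOut v∈inner)
        ⊆meet : listSet (x ∷ y ∷ []) ⊆ vertexSet S ∩ listSet (verts P)
        ⊆meet v∈ with ∈listSet⁻ (x ∷ y ∷ []) v∈
        ... | here refl         = x∈p∩q⁺ (∈⟦⟧⁺ (InVS? S) xInS , ∈listSet⁺ (verts P) (first∈ P))
        ... | there (here refl) = x∈p∩q⁺ (∈⟦⟧⁺ (InVS? S) yInS , ∈listSet⁺ (verts P) (last∈ P))

      -- Adding a BG-path of length ℓ adds ℓ edges and ℓ − 1 vertices.
      bgPath-gain : Gain (sizeS S) (sizeS (S ∪ edgeSet P)) 1
      bgPath-gain = gain-glue ℓ new-edges new-vertices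
        where
        ℓ = length (edgesW P)
        Vₛ = vertexSet S
        Vₚ = listSet (verts P)
        new-edges : ∣ S ∪ edgeSet P ∣ ≡ ∣ S ∣ + ℓ
        new-edges = trans (∣∪∣-disjoint S (edgeSet P) bgPath-edges-disjoint)
                          (cong (∣ S ∣ +_) (∣listSet∣ (edges-unique P (proj₂ P-isPath))))
        ∣x,y∣ : ∣ listSet (x ∷ y ∷ []) ∣ ≡ 2
        ∣x,y∣ = ∣listSet∣ ((path-ends-distinct P P-isPath ∷ []) ∷ [] ∷ [])
        new-vertices : ∣ vertexSet (S ∪ edgeSet P) ∣ + 2 ≡ ∣ Vₛ ∣ + suc ℓ
        new-vertices = begin
          ∣ vertexSet (S ∪ edgeSet P) ∣ + 2 ≡⟨ cong₂ _+_ (cong ∣_∣ (vertexSet-extend P (proj₁ P-isPath))) (sym ∣x,y∣) ⟩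
          ∣ Vₛ ∪ Vₚ ∣ + ∣ listSet (x ∷ y ∷ []) ∣ ≡⟨ cong (λ t → ∣ Vₛ ∪ Vₚ ∣ + ∣ t ∣) bgPath-meet ⟨
          ∣ Vₛ ∪ Vₚ ∣ + ∣ Vₛ ∩ Vₚ ∣          ≡⟨ ∣∪∣+∣∩∣ Vₛ Vₚ ⟩
          ∣ Vₛ ∣ + ∣ Vₚ ∣                    ≡⟨ cong (∣ Vₛ ∣ +_) (∣listSet∣ (proj₂ P-isPath)) ⟩
          ∣ Vₛ ∣ + length (verts P)          ≡⟨ cong (∣ Vₛ ∣ +_) (length-verts P) ⟩
          ∣ Vₛ ∣ + suc ℓ                     ∎

bgPathSeq-gain : ∀ {G S S' k} → BGPathSeq G S S' k → Gain (sizeS G S) (sizeS G S') k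
bgPathSeq-gain {G} {S} done          = gain-refl (sizeS G S)
bgPathSeq-gain {G} {S} (step P bg sq) = gain-trans (bgPath-gain G S P bg) (bgPathSeq-gain sq)

subdivision-K4-balance : ∀ {H} → SubdivOf K4 H → E H ≡ V H + 2
subdivision-K4-balance base      = refl
subdivision-K4-balance (sub s _) = cong suc (subdivision-K4-balance s)

subgraphIso-size : ∀ {H G S} → SubgraphIso H G S → sizeS G S ≡ size H
subgraphIso-size {G = G} {S} iso = cong₂ _,_
  (∣image∣ I.emap I.einj (λ e → lookup⇒[]= _ S (I.eimg₁ e)) (λ f f∈S → I.eimg₂ f ([]=⇒lookup f∈S)))
  (∣image∣ I.vmap I.vinj (λ u → ∈⟦⟧⁺ (InVS? G S) (I.vimg₁ u)) (λ v v∈ → I.vimg₂ v (∈⟦⟧⁻ (InVS? G S) v∈)))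
  where module I = SubgraphIso iso

-- In a 3-connected graph every vertex lies on an edge, so all edges span all of G.
spanning-size : ∀ {G} → ThreeConnected G → sizeS G ⊤ ≡ size G
spanning-size {G} (big , connected) =
  cong₂ _,_ (∣⊤∣≡n (E G)) (trans (cong ∣_∣ (⊆-antisym ⊆⊤ (λ {v} _ → covered v))) (∣⊤∣≡n (V G)))
  where
  covered : ∀ v → v ∈ vertexSet G ⊤
  covered v = let (w , v≢w) = another-element (≤-trans (s≤s (s≤s z≤n)) big) v
                  (walk , _) = connected [] z≤n v w (λ ()) (λ ())
                  (e , inc)  = first-edge walk v≢w
              in vertex-intro G ∈⊤ inc

lemma5 : (G : MG) → Simple G → ThreeConnected G →
    -- (a)
    (∀ (H : MG) (k : ℕ) → BGSeq K4 H k → H ≅ G → k ≡ E G ∸ V G ∸ 2) ×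
    -- (b)
    (∀ (S₀ S : Subset (E G)) (k : ℕ) → K4SubdivIn G S₀ → BGPathSeq G S₀ S k →
       S ≡ ⊤ → k ≡ E G ∸ V G ∸ 2) ×
    -- (c)
    (∀ (H : MG) (k : ℕ) → RemSeq G H k → H ≅ K4 → k ≡ E G ∸ V G ∸ 2)
lemma5 G _ tc = sequencesA , sequencesB , sequencesC
  where
  sequencesA : ∀ H k → BGSeq K4 H k → H ≅ G → k ≡ E G ∸ V G ∸ 2
  sequencesA H k sq H≅G =
    gain-from-2 refl (subst (λ t → Gain (size K4) t k) (≅⇒size≡ H≅G) (bgSeq-gain sq))

  sequencesB : ∀ S₀ S k → K4SubdivIn G S₀ → BGPathSeq G S₀ S k → S ≡ ⊤ → k ≡ E G ∸ V G ∸ 2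
  sequencesB S₀ S k (H , subdivision , iso) sq refl =
    gain-from-2 (subdivision-K4-balance subdivision)
      (subst₂ (λ s t → Gain s t k) (subgraphIso-size iso) (spanning-size tc) (bgPathSeq-gain sq))

  sequencesC : ∀ H k → RemSeq G H k → H ≅ K4 → k ≡ E G ∸ V G ∸ 2
  sequencesC H k sq H≅K4 =
    gain-from-2 refl (subst (λ s → Gain s (size G) k) (≅⇒size≡ H≅K4) (remSeq-gain sq))
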